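{- Let $e\ge2$, $c\in\mathbb Z$, $i\in\{0,\dots,e-1\}$, and let $\lambda,\mu$ be $c$-charged $e$-cores which either both have no addable $i$-nodes or both have no removable $i$-nodes. Then $Y(\lambda)\subseteq Y(\mu)$ if and only if $Y(s_i\lambda)\subseteq Y(s_i\mu)$.
   Context: A $c$-charged partition is a partition $\lambda=(\lambda_1\ge\dots\ge\lambda_h>0)$ with an integer $c$; $Y(\lambda)=\{(a,b):1\le a\le h,1\le b\le\lambda_a\}$; its abacus is $\{\lambda_k-k+c+1:k\ge1\}$ ($\lambda_k=0$ for $k>h$). It is an $e$-core if its abacus $A$ satisfies $x\in A\Rightarrow x-e\in A$. The residue of node $(a,b)$ is $b-a+c\bmod e$; an $i$-node has residue $i$. Addable/removable nodes: $\gamma\notin Y(\lambda)$ with $Y(\lambda)\cup\{\gamma\}$ a Young diagram / $\gamma\in Y(\lambda)$ with $Y(\lambda)\setminus\{\gamma\}$ a Young diagram. An $e$-core never has both an addable and a removable $i$-node. The generator $s_i$ of the affine symmetric group acts on a $c$-charged $e$-core $\lambda$ by adding all its addable $i$-nodes (if it has any) or removing all its removable $i$-nodes (equivalently, $s_i\lambda$ has abacus $s_i(A)$, where $s_i$ swaps $i+ke$ and $i+1+ke$ for all $k\in\mathbb Z$). -}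

module Defs where

open import Data.Nat as ℕ using (ℕ; zero; suc; _≤_; _<_; NonZero)
open import Data.Integer as ℤ using (ℤ; +_; _%ℕ_)
open import Data.List using (List; []; _∷_)
open import Data.List.Relation.Unary.All using (All)
open import Data.List.Relation.Unary.Linked using (Linked)
open import Data.Product using (_×_; _,_; ∃; ∃-syntax)
open import Data.Sum using (_⊎_)
open import Relation.Binary.PropositionalEquality using (_≡_)
open import Relation.Nullary using (¬_)

IsPartition : List ℕ → Set
IsPartition λs = Linked ℕ._≥_ λs × All (0 <_) λs

-- part λ k = λ_k (1-indexed), with λ_k = 0 for k > h (and for k = 0, unused).
part : List ℕ → ℕ → ℕ
part []       _             = 0
part (x ∷ xs) zero          = 0
part (x ∷ xs) (suc zero)    = x
part (x ∷ xs) (suc (suc k)) = part xs (suc k)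

-- Nodes (a , b) : row a, column b, both 1-indexed.
Node : Set
Node = ℕ × ℕ

-- Y(λ) = {(a,b) : 1 ≤ a ≤ h, 1 ≤ b ≤ λ_a}   (a ≤ h is forced by 1 ≤ b ≤ λ_a)
Y : List ℕ → Node → Set
Y λs (a , b) = 1 ≤ a × 1 ≤ b × b ≤ part λs a

_⊆Y_ : (Node → Set) → (Node → Set) → Set
S ⊆Y T = ∀ γ → S γ → T γ

IsYoungDiagram : (Node → Set) → Set
IsYoungDiagram S =
  (∀ a b → S (a , b) → 1 ≤ a × 1 ≤ b) ×
  (∀ a b a' b' → S (a , b) → 1 ≤ a' → a' ≤ a → 1 ≤ b' → b' ≤ b → S (a' , b'))

Addable : List ℕ → Node → Set
Addable λs γ = ¬ Y λs γ × IsYoungDiagram (λ δ → Y λs δ ⊎ δ ≡ γ)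

Removable : List ℕ → Node → Set
Removable λs γ = Y λs γ × IsYoungDiagram (λ δ → Y λs δ × ¬ δ ≡ γ)

InAbacus : ℤ → List ℕ → ℤ → Set
InAbacus c λs x = ∃[ k ] (1 ≤ k × x ≡ (+ part λs k ℤ.- + k) ℤ.+ c ℤ.+ + 1)

IsCore : (e : ℕ) → ℤ → List ℕ → Set
IsCore e c λs = ∀ x → InAbacus c λs x → InAbacus c λs (x ℤ.- + e)

residue : (e : ℕ) .{{_ : NonZero e}} → ℤ → Node → ℕ
residue e c (a , b) = ((+ b ℤ.- + a) ℤ.+ c) %ℕ e

AddableI : (e : ℕ) .{{_ : NonZero e}} → ℤ → ℕ → List ℕ → Node → Set
AddableI e c i λs γ = Addable λs γ × residue e c γ ≡ i

RemovableI : (e : ℕ) .{{_ : NonZero e}} → ℤ → ℕ → List ℕ → Node → Set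
RemovableI e c i λs γ = Removable λs γ × residue e c γ ≡ i

NoAddableI : (e : ℕ) .{{_ : NonZero e}} → ℤ → ℕ → List ℕ → Set
NoAddableI e c i λs = ∀ γ → ¬ AddableI e c i λs γ

NoRemovableI : (e : ℕ) .{{_ : NonZero e}} → ℤ → ℕ → List ℕ → Set
NoRemovableI e c i λs = ∀ γ → ¬ RemovableI e c i λs γ

-- IsSi e c i λ ν : ν is s_i λ, i.e. Y(ν) is obtained from Y(λ) by adding all
-- addable i-nodes and removing all removable i-nodes (for an e-core at most
-- one of these two sets is non-empty).
IsSi : (e : ℕ) .{{_ : NonZero e}} → ℤ → ℕ → List ℕ → List ℕ → Set
IsSi e c i λs νs =
  IsPartition νs ×
  (∀ γ → Y νs γ → (Y λs γ × ¬ RemovableI e c i λs γ) ⊎ AddableI e c i λs γ) ×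
  (∀ γ → (Y λs γ × ¬ RemovableI e c i λs γ) ⊎ AddableI e c i λs γ → Y νs γ)

-- Since e ≥ 2, the four neighbours of an i-node are
-- not i-nodes, and an i-node is addable (removable) exactly when its upper and left
-- neighbours lie in the diagram (its lower and right neighbours do not). So once every
-- non-i-node of λ lies in μ, an i-node missing from μ is addable to μ if it lies in λ or is
-- addable to λ, and is removable from λ if it lies in λ. Both Y(λ) ⊆ Y(μ) and
-- Y(s_i λ) ⊆ Y(s_i μ) put the non-i-nodes of λ into μ, because s_i changes only i-nodes;
-- the two cases of the hypothesis then rule out the offending addable or removable nodes.
module Submission where

open import Defs
open import Data.Nat using (ℕ; _≤_; _<_; NonZero)
open import Data.Integer using (ℤ)
open import Data.List using (List)
open import Data.Product using (_×_)
open import Data.Sum using (_⊎_)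
open import Function.Bundles using (_⇔_)

open import Data.Nat as ℕ using (zero; suc; z≤n; s≤s; _≥_; _≤′_; ≤′-refl; ≤′-step)
open import Data.Nat.Properties
  using (≤-refl; ≤-trans; n≤1+n; m≤n⇒m<n∨m≡n; ≤⇒≤′; <⇒≢; 1+n≢n; _≤?_; _≟_)
open import Data.Nat.Divisibility using (_∣_; divides; ∣1⇒≡1)
open import Data.Integer as ℤ using (+_; _%ℕ_; _/ℕ_)
open import Data.Integer.Properties using (abs-*)
open import Data.Integer.DivMod using (a≡a%ℕn+[a/ℕn]*n)
open import Data.Integer.Divisibility using () renaming (_∣_ to _∣ℤ_)
open import Data.Integer.Tactic.RingSolver using (solve-∀)
open import Data.Empty using (⊥-elim)
open import Data.Unit using (⊤; tt)
open import Data.List.Relation.Unary.Linked using (Linked; []; [-]; _∷_)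
open import Data.Product using (_,_; proj₁; proj₂)
open import Data.Sum using (inj₁; inj₂)
open import Function.Base using (_∘_)
open import Function.Bundles using (mk⇔)
open import Relation.Nullary using (¬_; Dec; yes; no)
open import Relation.Nullary.Decidable using (_×-dec_)
open import Relation.Binary.PropositionalEquality
  using (_≡_; _≢_; refl; sym; trans; cong; cong₂; subst; module ≡-Reasoning)

%ℕ-≡⇒∣ : ∀ {e} .{{_ : NonZero e}} x y → x %ℕ e ≡ y %ℕ e → + e ∣ℤ x ℤ.- y
%ℕ-≡⇒∣ {e} x y eq = divides ℤ.∣ q ∣ (begin
  ℤ.∣ x ℤ.- y ∣         ≡⟨ cong ℤ.∣_∣ x-y≡q*e ⟩
  ℤ.∣ q ℤ.* + e ∣       ≡⟨ abs-* q (+ e) ⟩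
  ℤ.∣ q ∣ ℕ.* e         ∎)
  where
  open ≡-Reasoning
  q : ℤ
  q = x /ℕ e ℤ.- y /ℕ e
  cancel : ∀ r s t u → (r ℤ.+ s ℤ.* u) ℤ.- (r ℤ.+ t ℤ.* u) ≡ (s ℤ.- t) ℤ.* u
  cancel = solve-∀
  x-y≡q*e : x ℤ.- y ≡ q ℤ.* + e
  x-y≡q*e = begin
    x ℤ.- y
      ≡⟨ cong₂ ℤ._-_ (a≡a%ℕn+[a/ℕn]*n x e) (a≡a%ℕn+[a/ℕn]*n y e) ⟩
    (+ (x %ℕ e) ℤ.+ x /ℕ e ℤ.* + e) ℤ.- (+ (y %ℕ e) ℤ.+ y /ℕ e ℤ.* + e)
      ≡⟨ cong (λ r → (+ r ℤ.+ x /ℕ e ℤ.* + e) ℤ.- (+ (y %ℕ e) ℤ.+ y /ℕ e ℤ.* + e)) eq ⟩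
    (+ (y %ℕ e) ℤ.+ x /ℕ e ℤ.* + e) ℤ.- (+ (y %ℕ e) ℤ.+ y /ℕ e ℤ.* + e)
      ≡⟨ cancel (+ (y %ℕ e)) (x /ℕ e) (y /ℕ e) (+ e) ⟩
    q ℤ.* + e
      ∎

suc-%ℕ-≢ : ∀ {e} .{{_ : NonZero e}} → 2 ≤ e → ∀ x → (x ℤ.+ + 1) %ℕ e ≢ x %ℕ e
suc-%ℕ-≢ {e} 2≤e x eq = <⇒≢ 2≤e (sym (∣1⇒≡1 e∣1))
  where
  [x+1]-x≡1 : ∀ x → (x ℤ.+ + 1) ℤ.- x ≡ + 1
  [x+1]-x≡1 = solve-∀
  e∣1 : e ∣ 1
  e∣1 = subst (λ z → + e ∣ℤ z) ([x+1]-x≡1 x) (%ℕ-≡⇒∣ (x ℤ.+ + 1) x eq)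

part-suc-≤ : ∀ {xs} → Linked _≥_ xs → ∀ a → part xs (suc (suc a)) ≤ part xs (suc a)
part-suc-≤ []        _       = z≤n
part-suc-≤ [-]       _       = z≤n
part-suc-≤ (x≥y ∷ _) zero    = x≥y
part-suc-≤ (_ ∷ l)   (suc a) = part-suc-≤ l a

part-antitone : ∀ {xs} → Linked _≥_ xs → ∀ {a a'} → a ≤′ a' → part xs (suc a') ≤ part xs (suc a)
part-antitone l ≤′-refl         = ≤-refl
part-antitone l (≤′-step a≤′a') = ≤-trans (part-suc-≤ l _) (part-antitone l a≤′a')

Y-downClosed : ∀ {xs} → IsPartition xs → ∀ {a b a' b'} → Y xs (a , b) →
  1 ≤ a' → a' ≤ a → 1 ≤ b' → b' ≤ b → Y xs (a' , b')
Y-downClosed (l , _) {suc a} (_ , _ , b≤) (s≤s z≤n) (s≤s a'≤a) 1≤b' b'≤b =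
  s≤s z≤n , 1≤b' , ≤-trans b'≤b (≤-trans b≤ (part-antitone l (≤⇒≤′ a'≤a)))

Y? : ∀ xs γ → Dec (Y xs γ)
Y? xs (a , b) = 1 ≤? a ×-dec 1 ≤? b ×-dec b ≤? part xs a

removable-corner : ∀ {xs} → IsPartition xs → ∀ {a b} → Y xs (a , b) →
  ¬ Y xs (suc a , b) → ¬ Y xs (a , suc b) → Removable xs (a , b)
removable-corner {xs} P {a} {b} y ¬below ¬right = y , positive , closed
  where
  positive : ∀ a₁ b₁ → Y xs (a₁ , b₁) × (a₁ , b₁) ≢ (a , b) → 1 ≤ a₁ × 1 ≤ b₁
  positive _ _ ((1≤a₁ , 1≤b₁ , _) , _) = 1≤a₁ , 1≤b₁
  closed : ∀ a₁ b₁ a₂ b₂ → Y xs (a₁ , b₁) × (a₁ , b₁) ≢ (a , b) →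
    1 ≤ a₂ → a₂ ≤ a₁ → 1 ≤ b₂ → b₂ ≤ b₁ → Y xs (a₂ , b₂) × (a₂ , b₂) ≢ (a , b)
  closed a₁ b₁ a₂ b₂ (y₁ , ≢γ) 1≤a₂ a₂≤a₁ 1≤b₂ b₂≤b₁ = Y-downClosed P y₁ 1≤a₂ a₂≤a₁ 1≤b₂ b₂≤b₁ , ≢γ'
    where
    ≢γ' : (a₂ , b₂) ≢ (a , b)
    ≢γ' refl with m≤n⇒m<n∨m≡n b₂≤b₁ | m≤n⇒m<n∨m≡n a₂≤a₁
    ... | inj₁ b<b₁    | _           = ¬right (Y-downClosed P y₁ 1≤a₂ a₂≤a₁ (s≤s z≤n) b<b₁)
    ... | inj₂ refl    | inj₁ a<a₁   = ¬below (Y-downClosed P y₁ (s≤s z≤n) a<a₁ 1≤b₂ b₂≤b₁)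
    ... | inj₂ refl    | inj₂ refl   = ≢γ refl

removable⇒¬Y-below : ∀ {xs a b} → Removable xs (a , b) → ¬ Y xs (suc a , b)
removable⇒¬Y-below {a = a} {b} ((1≤a , 1≤b , _) , _ , closed) y =
  proj₂ (closed (suc a) b a b (y , 1+n≢n ∘ cong proj₁) 1≤a (n≤1+n a) 1≤b ≤-refl) refl

removable⇒¬Y-right : ∀ {xs a b} → Removable xs (a , b) → ¬ Y xs (a , suc b)
removable⇒¬Y-right {a = a} {b} ((1≤a , 1≤b , _) , _ , closed) y =
  proj₂ (closed a (suc b) a b (y , 1+n≢n ∘ cong proj₂) 1≤a ≤-refl 1≤b (n≤1+n b)) refl

removable-⊆ : ∀ {λs μs} → IsPartition λs → Y λs ⊆Y Y μs →
  ∀ {γ} → Y λs γ → Removable μs γ → Removable λs γ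
removable-⊆ {μs = μs} Pλ λ⊆μ {_ , _} y rm = removable-corner Pλ y
  (removable⇒¬Y-below {μs} rm ∘ λ⊆μ _) (removable⇒¬Y-right {μs} rm ∘ λ⊆μ _)

-- Nodes in row (column) 1 have no upper (left) neighbour.
AboveIn : List ℕ → Node → Set
AboveIn xs (suc (suc a) , b) = Y xs (suc a , b)
AboveIn xs _                 = ⊤

LeftIn : List ℕ → Node → Set
LeftIn xs (a , suc (suc b)) = Y xs (a , suc b)
LeftIn xs _                 = ⊤

Supported : List ℕ → Node → Set
Supported xs (a , b) = 1 ≤ a × 1 ≤ b × AboveIn xs (a , b) × LeftIn xs (a , b)

above-closed : ∀ {xs} → IsPartition xs → ∀ {a b a' b'} → AboveIn xs (a , b) →
  1 ≤ a' → a' < a → 1 ≤ b' → b' ≤ b → Y xs (a' , b')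
above-closed P {suc (suc a)} y 1≤a' (s≤s a'≤1+a) 1≤b' b'≤b = Y-downClosed P y 1≤a' a'≤1+a 1≤b' b'≤b
above-closed P {suc zero} _ (s≤s z≤n) (s≤s ()) _ _

left-closed : ∀ {xs} → IsPartition xs → ∀ {a b a' b'} → LeftIn xs (a , b) →
  1 ≤ a' → a' ≤ a → 1 ≤ b' → b' < b → Y xs (a' , b')
left-closed P {b = suc (suc b)} y 1≤a' a'≤a 1≤b' (s≤s b'≤1+b) = Y-downClosed P y 1≤a' a'≤a 1≤b' b'≤1+b
left-closed P {b = suc zero} _ _ _ (s≤s z≤n) (s≤s ())

supported⇒addable : ∀ {xs} → IsPartition xs → ∀ {γ} → Supported xs γ → ¬ Y xs γ → Addable xs γ
supported⇒addable {xs} P {a , b} (1≤a , 1≤b , above , left) ∉ = ∉ , positive , closed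
  where
  positive : ∀ a₁ b₁ → Y xs (a₁ , b₁) ⊎ (a₁ , b₁) ≡ (a , b) → 1 ≤ a₁ × 1 ≤ b₁
  positive _ _ (inj₁ (1≤a₁ , 1≤b₁ , _)) = 1≤a₁ , 1≤b₁
  positive _ _ (inj₂ refl)              = 1≤a , 1≤b
  closed : ∀ a₁ b₁ a₂ b₂ → Y xs (a₁ , b₁) ⊎ (a₁ , b₁) ≡ (a , b) →
    1 ≤ a₂ → a₂ ≤ a₁ → 1 ≤ b₂ → b₂ ≤ b₁ → Y xs (a₂ , b₂) ⊎ (a₂ , b₂) ≡ (a , b)
  closed _ _ _ _ (inj₁ y) 1≤a₂ a₂≤a₁ 1≤b₂ b₂≤b₁ = inj₁ (Y-downClosed P y 1≤a₂ a₂≤a₁ 1≤b₂ b₂≤b₁)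
  closed _ _ _ _ (inj₂ refl) 1≤a₂ a₂≤a 1≤b₂ b₂≤b with m≤n⇒m<n∨m≡n a₂≤a | m≤n⇒m<n∨m≡n b₂≤b
  ... | inj₁ a₂<a | _         = inj₁ (above-closed P above 1≤a₂ a₂<a 1≤b₂ b₂≤b)
  ... | inj₂ refl | inj₁ b₂<b = inj₁ (left-closed P left 1≤a₂ a₂≤a 1≤b₂ b₂<b)
  ... | inj₂ refl | inj₂ refl = inj₂ refl

addable⇒aboveIn : ∀ {xs γ} → Addable xs γ → AboveIn xs γ
addable⇒aboveIn {γ = zero , _}        _ = tt
addable⇒aboveIn {γ = suc zero , _}    _ = tt
addable⇒aboveIn {γ = suc (suc a) , b} (_ , positive , closed)
  with closed (suc (suc a)) b (suc a) b (inj₂ refl)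
              (s≤s z≤n) (n≤1+n _) (proj₂ (positive _ _ (inj₂ refl))) ≤-refl
... | inj₁ y  = y
... | inj₂ eq = ⊥-elim (1+n≢n (sym (cong proj₁ eq)))

addable⇒leftIn : ∀ {xs γ} → Addable xs γ → LeftIn xs γ
addable⇒leftIn {γ = _ , zero}        _ = tt
addable⇒leftIn {γ = _ , suc zero}    _ = tt
addable⇒leftIn {γ = a , suc (suc b)} (_ , positive , closed)
  with closed a (suc (suc b)) a (suc b) (inj₂ refl)
              (proj₁ (positive _ _ (inj₂ refl))) ≤-refl (s≤s z≤n) (n≤1+n _)
... | inj₁ y  = y
... | inj₂ eq = ⊥-elim (1+n≢n (sym (cong proj₂ eq)))

addable⇒supported : ∀ {xs γ} → Addable xs γ → Supported xs γ
addable⇒supported {γ = a , b} add@(_ , positive , _) with positive a b (inj₂ refl)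
... | 1≤a , 1≤b = 1≤a , 1≤b , addable⇒aboveIn add , addable⇒leftIn add

Y⇒supported : ∀ {xs} → IsPartition xs → ∀ {γ} → Y xs γ → Supported xs γ
Y⇒supported {xs} P {a , b} y@(1≤a , 1≤b , _) = 1≤a , 1≤b , above a y , left b y
  where
  above : ∀ a → Y xs (a , b) → AboveIn xs (a , b)
  above zero          _ = tt
  above (suc zero)    _ = tt
  above (suc (suc a)) y = Y-downClosed P y (s≤s z≤n) (n≤1+n _) 1≤b ≤-refl
  left : ∀ b → Y xs (a , b) → LeftIn xs (a , b)
  left zero          _ = tt
  left (suc zero)    _ = tt
  left (suc (suc b)) y = Y-downClosed P y 1≤a ≤-refl (s≤s z≤n) (n≤1+n _)

module _ (e : ℕ) .{{_ : NonZero e}} (2≤e : 2 ≤ e) (c : ℤ) (i : ℕ) where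

  residue-below-≢ : ∀ a b → residue e c (suc a , b) ≢ residue e c (a , b)
  residue-below-≢ a b eq =
    suc-%ℕ-≢ 2≤e ((+ b ℤ.- + suc a) ℤ.+ c) (trans (cong (_%ℕ e) (shift (+ b) (+ a) c)) (sym eq))
    where
    shift : ∀ b a c → ((b ℤ.- (+ 1 ℤ.+ a)) ℤ.+ c) ℤ.+ + 1 ≡ (b ℤ.- a) ℤ.+ c
    shift = solve-∀

  residue-right-≢ : ∀ a b → residue e c (a , suc b) ≢ residue e c (a , b)
  residue-right-≢ a b eq =
    suc-%ℕ-≢ 2≤e ((+ b ℤ.- + a) ℤ.+ c) (trans (cong (_%ℕ e) (sym (shift (+ b) (+ a) c))) eq)
    where
    shift : ∀ b a c → ((+ 1 ℤ.+ b) ℤ.- a) ℤ.+ c ≡ ((b ℤ.- a) ℤ.+ c) ℤ.+ + 1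
    shift = solve-∀

  Y∖i : List ℕ → Node → Set
  Y∖i xs γ = Y xs γ × residue e c γ ≢ i

  aboveIn-transfer : ∀ {λs μs} → Y∖i λs ⊆Y Y μs →
    ∀ {γ} → residue e c γ ≡ i → AboveIn λs γ → AboveIn μs γ
  aboveIn-transfer _   {zero , _}        _  _ = tt
  aboveIn-transfer _   {suc zero , _}    _  _ = tt
  aboveIn-transfer λ⊆μ {suc (suc a) , b} rγ y =
    λ⊆μ _ (y , λ r → residue-below-≢ (suc a) b (trans rγ (sym r)))

  leftIn-transfer : ∀ {λs μs} → Y∖i λs ⊆Y Y μs →
    ∀ {γ} → residue e c γ ≡ i → LeftIn λs γ → LeftIn μs γ
  leftIn-transfer _   {_ , zero}        _  _ = tt
  leftIn-transfer _   {_ , suc zero}    _  _ = tt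
  leftIn-transfer λ⊆μ {a , suc (suc b)} rγ y =
    λ⊆μ _ (y , λ r → residue-right-≢ a (suc b) (trans rγ (sym r)))

  Y∖i-⊆⇒addableI : ∀ {λs μs} → IsPartition μs → Y∖i λs ⊆Y Y μs →
    ∀ {γ} → residue e c γ ≡ i → Supported λs γ → ¬ Y μs γ → AddableI e c i μs γ
  Y∖i-⊆⇒addableI Pμ λ⊆μ {_ , _} rγ (1≤a , 1≤b , above , left) ∉ =
    supported⇒addable Pμ (1≤a , 1≤b , aboveIn-transfer λ⊆μ rγ above , leftIn-transfer λ⊆μ rγ left) ∉
    , rγ

  Y∖i-⊆⇒removableI : ∀ {λs μs} → IsPartition λs → IsPartition μs → Y∖i λs ⊆Y Y μs →
    ∀ {γ} → residue e c γ ≡ i → Y λs γ → ¬ Y μs γ → RemovableI e c i λs γ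
  Y∖i-⊆⇒removableI {λs} Pλ Pμ λ⊆μ {a , b} rγ y@(1≤a , 1≤b , _) ∉ =
    removable-corner Pλ y ¬below ¬right , rγ
    where
    ¬below : ¬ Y λs (suc a , b)
    ¬below y' = ∉ (Y-downClosed Pμ (λ⊆μ _ (y' , λ r → residue-below-≢ a b (trans r (sym rγ))))
                                 1≤a (n≤1+n a) 1≤b ≤-refl)
    ¬right : ¬ Y λs (a , suc b)
    ¬right y' = ∉ (Y-downClosed Pμ (λ⊆μ _ (y' , λ r → residue-right-≢ a b (trans r (sym rγ))))
                                 1≤a ≤-refl 1≤b (n≤1+n b))

  si-⊆⇒Y∖i-⊆ : ∀ {λs μs sλ sμ} → IsSi e c i λs sλ → IsSi e c i μs sμ →
    Y sλ ⊆Y Y sμ → Y∖i λs ⊆Y Y μs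
  si-⊆⇒Y∖i-⊆ (_ , _ , into-sλ) (_ , from-sμ , _) sλ⊆sμ γ (y , r≢)
    with from-sμ γ (sλ⊆sμ γ (into-sλ γ (inj₁ (y , r≢ ∘ proj₂))))
  ... | inj₁ (yμ , _) = yμ
  ... | inj₂ (_ , r)  = ⊥-elim (r≢ r)

  ⊆⇒si-⊆-removing : ∀ {λs μs sλ sμ} → IsPartition λs → NoAddableI e c i λs →
    IsSi e c i λs sλ → IsSi e c i μs sμ → Y λs ⊆Y Y μs → Y sλ ⊆Y Y sμ
  ⊆⇒si-⊆-removing {μs = μs} Pλ noAdd (_ , from-sλ , _) (_ , _ , into-sμ) λ⊆μ γ y with from-sλ γ y
  ... | inj₁ (yλ , ¬rm) =
    into-sμ γ (inj₁ (λ⊆μ γ yλ , λ (rm , r) → ¬rm (removable-⊆ {μs = μs} Pλ λ⊆μ yλ rm , r)))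
  ... | inj₂ add        = ⊥-elim (noAdd γ add)

  si-⊆⇒⊆-removing : ∀ {λs μs sλ sμ} → IsPartition λs → IsPartition μs → NoAddableI e c i μs →
    IsSi e c i λs sλ → IsSi e c i μs sμ → Y sλ ⊆Y Y sμ → Y λs ⊆Y Y μs
  si-⊆⇒⊆-removing {λs} {μs} Pλ Pμ noAdd sλ-is sμ-is sλ⊆sμ γ y with residue e c γ ≟ i
  ... | no r≢ = si-⊆⇒Y∖i-⊆ {λs} {μs} sλ-is sμ-is sλ⊆sμ γ (y , r≢)
  ... | yes r with Y? μs γ
  ...   | yes yμ = yμ
  ...   | no ∉   = ⊥-elim (noAdd γ (Y∖i-⊆⇒addableI Pμ (si-⊆⇒Y∖i-⊆ {λs} {μs} sλ-is sμ-is sλ⊆sμ) r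
                                                     (Y⇒supported Pλ y) ∉))

  ⊆⇒si-⊆-adding : ∀ {λs μs sλ sμ} → IsPartition μs → NoRemovableI e c i μs →
    IsSi e c i λs sλ → IsSi e c i μs sμ → Y λs ⊆Y Y μs → Y sλ ⊆Y Y sμ
  ⊆⇒si-⊆-adding {λs} {μs} Pμ noRm (_ , from-sλ , _) (_ , _ , into-sμ) λ⊆μ γ y with from-sλ γ y
  ... | inj₁ (yλ , _) = into-sμ γ (inj₁ (λ⊆μ γ yλ , noRm γ))
  ... | inj₂ (add , r) with Y? μs γ
  ...   | yes yμ = into-sμ γ (inj₁ (yμ , noRm γ))
  ...   | no ∉   =
    into-sμ γ (inj₂ (Y∖i-⊆⇒addableI {λs} Pμ (λ δ → λ⊆μ δ ∘ proj₁) r (addable⇒supported add) ∉))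

  si-⊆⇒⊆-adding : ∀ {λs μs sλ sμ} → IsPartition λs → IsPartition μs → NoRemovableI e c i λs →
    IsSi e c i λs sλ → IsSi e c i μs sμ → Y sλ ⊆Y Y sμ → Y λs ⊆Y Y μs
  si-⊆⇒⊆-adding {λs} {μs} Pλ Pμ noRm sλ-is@(_ , _ , into-sλ) sμ-is@(_ , from-sμ , _) sλ⊆sμ γ y
    with from-sμ γ (sλ⊆sμ γ (into-sλ γ (inj₁ (y , noRm γ))))
  ... | inj₁ (yμ , _)      = yμ
  ... | inj₂ ((∉ , _) , r) =
    ⊥-elim (noRm γ (Y∖i-⊆⇒removableI Pλ Pμ (si-⊆⇒Y∖i-⊆ {λs} {μs} sλ-is sμ-is sλ⊆sμ) r y ∉))

lemma3p5 : (e : ℕ) .{{_ : NonZero e}} → 2 ≤ e → (c : ℤ) → (i : ℕ) → i < e →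
    (λs μs : List ℕ) → IsPartition λs → IsPartition μs →
    IsCore e c λs → IsCore e c μs →
    (NoAddableI e c i λs × NoAddableI e c i μs) ⊎ (NoRemovableI e c i λs × NoRemovableI e c i μs) →
    (sλ sμ : List ℕ) → IsSi e c i λs sλ → IsSi e c i μs sμ →
    (Y λs ⊆Y Y μs) ⇔ (Y sλ ⊆Y Y sμ)
lemma3p5 e 2≤e c i _ λs μs Pλ Pμ _ _ (inj₁ (noAddλ , noAddμ)) sλ sμ sλ-is sμ-is =
  mk⇔ (⊆⇒si-⊆-removing e 2≤e c i {λs} {μs} Pλ noAddλ sλ-is sμ-is)
      (si-⊆⇒⊆-removing e 2≤e c i Pλ Pμ noAddμ sλ-is sμ-is)
lemma3p5 e 2≤e c i _ λs μs Pλ Pμ _ _ (inj₂ (noRmλ , noRmμ)) sλ sμ sλ-is sμ-is =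
  mk⇔ (⊆⇒si-⊆-adding e 2≤e c i {λs} {μs} Pμ noRmμ sλ-is sμ-is)
      (si-⊆⇒⊆-adding e 2≤e c i Pλ Pμ noRmλ sλ-is sμ-is)
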